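{- Let $n,m\ge 0$ and let $f_1,\ldots,f_\ell$ be functions in ${\sf PCSF}$, each of the form $f_i(x_1,\ldots,x_n/b_1,\ldots,b_m)$. Then there exists a monotonic polynomial $q(x_1,\ldots,x_n)$ such that the following holds. For any hereditarily finite sets $Z_1,\ldots,Z_n$, any $k\ge 0$ and functions $g_1,\ldots,g_m\in{\sf PCSF}$ each of the form $g_j(x_1,\ldots,x_n/a_1,\ldots,a_k)$, any hereditarily finite sets $A_1,\ldots,A_k$ and $B$, and any sequences $\alpha(g_1),\ldots,\alpha(g_m),\alpha(f_1),\ldots,\alpha(f_\ell)\in\mathbb{N}^n$, putting \[S_g=\bigcup\{g_j(\vec X/\vec A): 1\le j\le m,\ \vec X\in\vec Z^{(\alpha(g_j))}\},\] \[S_f=\bigcup\{f_i(\vec X^{f_i}/g_1(\vec X^{g_1}/\vec A),\ldots,g_m(\vec X^{g_m}/\vec A)): 1\le i\le\ell,\ \vec X^{f_i}\in\vec Z^{(\alpha(f_i))},\ \vec X^{g_j}\in\vec Z^{(\alpha(g_j))}\text{ for all }1\le j\le m\},\] we have \[cT(B\cup(A_1\cup\cdots\cup A_k)\cup S_g\cup S_f)\le q(cT(Z_1),\ldots,cT(Z_n))+cT(B\cup(A_1\cup\cdots\cup A_k)\cup S_g).\]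
   Context: $cT(X)=\mathrm{card}(\mathrm{TC}(X))$ is the cardinality of the transitive closure of $X$. For a set $Z$, $Z^{(0)}=Z$ and $Z^{(r+1)}=\bigcup(Z^{(r)})$. For $\alpha=(\alpha_1,\ldots,\alpha_n)\in\mathbb{N}^n$ and $\vec X=X_1,\ldots,X_n$, $\vec X\in\vec Z^{(\alpha)}$ means $X_i\in Z_i^{(\alpha_i)}$ for all $i\le n$. A polynomial $p$ is monotonic if $x_i<y_i$ implies $p(\ldots,x_i,\ldots)<p(\ldots,y_i,\ldots)$ for each $i$. Functions are set-theoretic functions on the universe of sets, written $f(x_1,\ldots,x_n/a_1,\ldots,a_m)$: arguments before the slash are called normal, after it safe (either list may be empty, written $-$). The class ${\sf PCSF}^-$ consists of functions with no normal arguments; it contains the projections $\pi^{ -,m}_j(-/a_1,\ldots,a_m)=a_j$, $\mathrm{pair}(-/a,b)=\{a,b\}$, $\mathrm{null}(-/-)=\emptyset$, $\mathrm{union}(-/a)=\bigcup a$, and $\mathrm{Cond}_\in(-/a,b,c,d)$, which equals $a$ if $c\in d$ and $b$ otherwise; and it is closed under composition $f(-/\vec a)=h(-/t_1(-/\vec a),\ldots,t_k(-/\vec a))$ and under safe separation: if $h(-/\vec a,b)\in{\sf PCSF}^-$ then $f(-/\vec a,c)=\{b\in c: h(-/\vec a,b)\neq\emptyset\}\in{\sf PCSF}^-$. The class ${\sf PCSF}$ is the smallest class containing ${\sf PCSF}^-$ and all projections $\pi^{n,m}_j(x_1,\ldots,x_n/x_{n+1},\ldots,x_{n+m})=x_j$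 ($1\le j\le n+m$), and closed under safe composition $f(\vec x/\vec a)=h(r_1(\vec x/-),\ldots,r_k(\vec x/-)/t_1(\vec x/\vec a),\ldots,t_l(\vec x/\vec a))$ (with $h,r_i,t_j\in{\sf PCSF}$, the $r_i$ having no safe arguments) and predicative set recursion $f(x,\vec y/\vec a)=h(x,\vec y/\vec a,\{f(z,\vec y/\vec a): z\in x\})$ (with $h\in{\sf PCSF}$). -}

module Defs where

open import Data.Bool using (Bool; true; false; if_then_else_; not)
open import Data.Nat using (ℕ; zero; suc; _+_; _*_; _^_; _<_; _≤_; _≡ᵇ_; _%_; ⌊_/2⌋)
open import Data.Fin using (Fin; fromℕ)
open import Data.List using (List; []; _∷_; filterᵇ; upTo; map; concatMap; length; allFin)
import Data.List as L
open import Data.Vec.Functional using (Vector; insertAt; tail; head; updateAt)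
import Data.Vec.Functional as V

-- Hereditarily finite sets, via the Ackermann coding:
-- a natural number y codes the HF set whose elements are the codes x
-- such that bit x of y is 1.  This is a bijection ℕ ≅ V_ω, under which
-- set equality is ≡ on ℕ.

HF : Set
HF = ℕ

testBit : ℕ → ℕ → Bool
testBit y zero    = y % 2 ≡ᵇ 1
testBit y (suc x) = testBit ⌊ y /2⌋ x

mem : HF → HF → Bool
mem x y = testBit y x

-- the elements of y (every element x of y satisfies x < y)
elems : HF → List HF
elems y = filterᵇ (λ x → mem x y) (upTo y)

insertS : HF → HF → HF
insertS a s = if mem a s then s else s + 2 ^ a

fromList : List HF → HF
fromList = L.foldr insertS 0

∅ : HF
∅ = 0

infixl 6 _∪_
_∪_ : HF → HF → HF
a ∪ b = fromList (elems a L.++ elems b)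

⋃ : HF → HF
⋃ a = fromList (concatMap elems (elems a))

pairS : HF → HF → HF
pairS a b = insertS a (insertS b ∅)

card : HF → ℕ
card s = length (elems s)

iterU : ℕ → HF → HF
iterU zero    z = z
iterU (suc r) z = ⋃ (iterU r z)

-- transitive closure TC(X) = ⋃_{r ≥ 0} X^(r); X^(r) = ∅ for r ≥ X
-- (codes of elements are strictly smaller), so r ≤ X suffices.
TC : HF → HF
TC x = fromList (concatMap (λ r → elems (iterU r x)) (upTo (suc x)))

cT : HF → ℕ
cT x = card (TC x)

⋃ᵥ : ∀ {k} → Vector HF k → HF
⋃ᵥ = V.foldr _∪_ ∅

-- Syntax of PCSF⁻ (functions f(-/a_1,…,a_m)); index = number of safe args

data PCSF⁻ : ℕ → Set where
  proj⁻  : ∀ {m} → Fin m → PCSF⁻ m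
  pair⁻  : PCSF⁻ 2
  null⁻  : PCSF⁻ 0
  union⁻ : PCSF⁻ 1
  cond⁻  : PCSF⁻ 4
  comp⁻  : ∀ {m k} → PCSF⁻ k → (Fin k → PCSF⁻ m) → PCSF⁻ m
  -- safe separation: from h(-/a⃗,b) get f(-/a⃗,c) = {b ∈ c : h(-/a⃗,b) ≠ ∅}
  sep⁻   : ∀ {m} → PCSF⁻ (suc m) → PCSF⁻ (suc m)

snoc : ∀ {A : Set} {m} → Vector A m → A → Vector A (suc m)
snoc {m = m} v x = insertAt v (fromℕ m) x

initV : ∀ {A : Set} {m} → Vector A (suc m) → Vector A m
initV {m = zero}  v ()
initV {m = suc m} v Fin.zero    = v Fin.zero
initV {m = suc m} v (Fin.suc i) = initV (tail v) i

lastV : ∀ {A : Set} {m} → Vector A (suc m) → A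
lastV {m = m} v = v (fromℕ m)

eval⁻ : ∀ {m} → PCSF⁻ m → Vector HF m → HF
eval⁻ (proj⁻ j)   a = a j
eval⁻ pair⁻       a = pairS (a Fin.zero) (a (Fin.suc Fin.zero))
eval⁻ null⁻       a = ∅
eval⁻ union⁻      a = ⋃ (a Fin.zero)
eval⁻ cond⁻       a = if mem (a (Fin.suc (Fin.suc Fin.zero))) (a (Fin.suc (Fin.suc (Fin.suc Fin.zero))))
                        then a Fin.zero else a (Fin.suc Fin.zero)
eval⁻ (comp⁻ h t) a = eval⁻ h (λ i → eval⁻ (t i) a)
eval⁻ (sep⁻ h)    a = fromList (filterᵇ (λ b → not (eval⁻ h (snoc (initV a) b) ≡ᵇ 0))
                                        (elems (lastV a)))

-- Syntax of PCSF: PCSF n m = functions f(x_1,…,x_n / a_1,…,a_m)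

data PCSF : ℕ → ℕ → Set where
  minus : ∀ {m} → PCSF⁻ m → PCSF 0 m
  -- π^{n,m}_j(x⃗/a⃗) = x_j, 1 ≤ j ≤ n+m (normal args first, then safe args)
  proj  : ∀ {n m} → Fin (n + m) → PCSF n m
  -- safe composition f(x⃗/a⃗) = h(r⃗(x⃗/-) / t⃗(x⃗/a⃗))
  scomp : ∀ {n m k l} → PCSF k l → (Fin k → PCSF n 0) → (Fin l → PCSF n m) → PCSF n m
  -- predicative set recursion f(x,y⃗/a⃗) = h(x,y⃗/a⃗,{f(z,y⃗/a⃗) : z ∈ x})
  rec   : ∀ {n m} → PCSF (suc n) (suc m) → PCSF (suc n) m

mutual
  eval : ∀ {n m} → PCSF n m → Vector HF n → Vector HF m → HF
  eval (minus h)      xs as = eval⁻ h as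
  eval (proj j)       xs as = (xs V.++ as) j
  eval (scomp h r t)  xs as = eval h (λ i → eval (r i) xs (λ ())) (λ i → eval (t i) xs as)
  eval (rec h)        xs as = recAux h (suc (head xs)) (head xs) (tail xs) as

  -- the recursion with fuel; fuel x+1 always suffices since z ∈ x ⇒ z < x,
  -- so recAux h (suc x) x computes exactly f(x, y⃗ / a⃗).
  recAux : ∀ {n m} → PCSF (suc n) (suc m) → ℕ → HF → Vector HF n → Vector HF m → HF
  recAux h zero    x ys as = ∅
  recAux h (suc k) x ys as =
    eval h (x V.∷ ys) (snoc as (fromList (map (λ z → recAux h k z ys as) (elems x))))

data Poly (n : ℕ) : Set where
  const : ℕ → Poly n
  var   : Fin n → Poly n
  _⊕_   : Poly n → Poly n → Poly n
  _⊗_   : Poly n → Poly n → Poly n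

evalP : ∀ {n} → Poly n → Vector ℕ n → ℕ
evalP (const c) v = c
evalP (var i)   v = v i
evalP (p ⊕ q)   v = evalP p v + evalP q v
evalP (p ⊗ q)   v = evalP p v * evalP q v

Monotonic : ∀ {n} → Poly n → Set
Monotonic {n} p = ∀ (v : Vector ℕ n) (i : Fin n) (y : ℕ) →
  v i < y → evalP p v < evalP p (updateAt v i (λ _ → y))

tuples : ∀ {A : Set} n → (Fin n → List A) → List (Vector A n)
tuples zero    L = (λ ()) ∷ []
tuples (suc n) L = concatMap (λ a → map (a V.∷_) (tuples n (tail L))) (L Fin.zero)
  where import Data.Fin as Fin

-- all X⃗ with X⃗ ∈ Z⃗^(α), i.e. X_i ∈ Z_i^(α_i)
box : ∀ {n} → Vector HF n → Vector ℕ n → List (Vector HF n)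
box {n} Z α = tuples n (λ i → elems (iterU (α i) (Z i)))

Sg : ∀ {n m k} → Vector HF n → (Fin m → PCSF n k) → Vector HF k → (Fin m → Vector ℕ n) → HF
Sg {m = m} Z g A αg =
  fromList (concatMap (λ j → concatMap (λ X → elems (eval (g j) X A)) (box Z (αg j))) (allFin m))

Sf : ∀ {n m k ℓ} → Vector HF n → (Fin ℓ → PCSF n m) → (Fin m → PCSF n k) → Vector HF k →
     (Fin m → Vector ℕ n) → (Fin ℓ → Vector ℕ n) → HF
Sf {m = m} {ℓ = ℓ} Z f g A αg αf =
  fromList (concatMap (λ i →
    concatMap (λ Xf →
      concatMap (λ Xg → elems (eval (f i) Xf (λ j → eval (g j) (Xg j) A)))
                (tuples m (λ j → box Z (αg j))))
      (box Z (αf i)))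
    (allFin ℓ))

module Submission where

-- The heart of the proof is a covering lemma (`covered`): for every f ∈ PCSF there is
-- a polynomial p_f such that every element of {f(x⃗/a⃗)} ∪ TC(f(x⃗/a⃗)) lies in
-- {x_i} ∪ TC(x_i) for a normal argument, or in {a_j} ∪ TC(a_j) for a safe argument,
-- or in an explicit list of at most p_f(cT(x⃗)) new sets, whatever a⃗ is.  It is proved
-- by induction on f: basic functions create at most one new set, safe composition
-- collects the new sets of its parts (the closures of the normal values r_i(x⃗/-) are
-- themselves bounded by the lemma), and set recursion creates, for each w ∈ {x} ∪ TC(x),
-- the set {f(z,…) : z ∈ w} and the new sets of the step function at w.
-- The theorem then applies the covering lemma to each f_i at every choice of X⃗^{f_i}
-- and X⃗^{g_j}: an element of TC(S_f) outside TC(B ∪ A⃗ ∪ S_g) lies in some TC(Z_i), is a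
-- value g_j(X⃗/A⃗), or is a new set of f_i, and q counts these three kinds.

open import Defs
open import Data.Bool using (Bool; true; false; T; T?; _∨_; not)
open import Data.Bool.Properties using (T-∨)
open import Data.Empty using (⊥-elim)
open import Data.Fin using (Fin; zero; suc; fromℕ)
import Data.Fin as Fin
open import Data.List using (List; []; _∷_; _++_; upTo; concatMap; length; map; filterᵇ; allFin)
open import Data.List.Properties using (length-removeAt′; length-++; length-map; map-cong-local)
open import Data.List.Membership.Propositional using (_∈_; find; lose)
open import Data.List.Membership.Propositional.Properties
  using (∈-filter⁻; ∈-filter⁺; ∈-upTo⁺; ∈-++⁻; ∈-++⁺ˡ; ∈-++⁺ʳ; ∈-concatMap⁻; ∈-concatMap⁺; ∈-map⁻; ∈-map⁺; ∈-allFin)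
import Data.List.Relation.Unary.All as All
open import Data.List.Relation.Unary.AllPairs using (_∷_)
open import Data.List.Relation.Unary.Any using (here; there; _─_; index)
open import Data.List.Relation.Unary.Unique.Propositional using (Unique)
import Data.List.Relation.Unary.Unique.Propositional.Properties as Unique
open import Data.Nat using (ℕ; zero; suc; _+_; _*_; _^_; _<_; _≤_; _≡ᵇ_; _%_; ⌊_/2⌋; ⌈_/2⌉; z≤n; s≤s)
open import Data.Nat.DivMod using ([m+kn]%n≡m%n)
open import Data.Nat.Induction using (<-wellFounded)
open import Data.Nat.Properties
open import Data.Product using (Σ; _×_; _,_; proj₁; proj₂; ∃)
open import Data.Sum using (_⊎_; inj₁; inj₂; [_,_]; [_,_]′) renaming (map to map⊎)
open import Data.Vec.Functional using (Vector; updateAt)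
import Data.Vec.Functional as V
open import Data.Vec.Functional.Properties using (updateAt-updates; updateAt-minimal)
open import Function using (_∘_; Equivalence)
open import Induction.WellFounded using (Acc; acc)
open import Relation.Binary.PropositionalEquality
  using (_≡_; _≢_; refl; sym; trans; cong; cong₂; subst; module ≡-Reasoning)
open import Relation.Nullary using (¬_; yes; no)

double-half≤ : ∀ y → 2 * ⌊ y /2⌋ ≤ y
double-half≤ y = begin
  ⌊ y /2⌋ + (⌊ y /2⌋ + 0) ≡⟨ cong (⌊ y /2⌋ +_) (+-identityʳ ⌊ y /2⌋) ⟩
  ⌊ y /2⌋ + ⌊ y /2⌋       ≤⟨ +-monoʳ-≤ ⌊ y /2⌋ (⌊n/2⌋≤⌈n/2⌉ y) ⟩
  ⌊ y /2⌋ + ⌈ y /2⌉       ≡⟨ ⌊n/2⌋+⌈n/2⌉≡n y ⟩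
  y                       ∎
  where open ≤-Reasoning

bit⇒2^≤ : ∀ y x → T (testBit y x) → 2 ^ x ≤ y
bit⇒2^≤ (suc y) zero    _   = s≤s z≤n
bit⇒2^≤ y       (suc x) set = ≤-trans (*-monoʳ-≤ 2 (bit⇒2^≤ ⌊ y /2⌋ x set)) (double-half≤ y)

n<2^n : ∀ n → n < 2 ^ n
n<2^n zero    = s≤s z≤n
n<2^n (suc n) = +-mono-≤ (m^n>0 2 n) (≤-trans (n<2^n n) (m≤m+n (2 ^ n) 0))

private
  -- the arithmetic behind `insertBit`: adding an even number 2k to s
  -- leaves the lowest bit of s alone and adds k to the remaining bits
  two-more : ∀ s k → s + 2 * suc k ≡ suc (suc (s + 2 * k))
  two-more s k = begin
    s + 2 * suc k            ≡⟨ cong (s +_) (*-suc 2 k) ⟩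
    s + suc (suc (2 * k))    ≡⟨ +-suc s (suc (2 * k)) ⟩
    suc (s + suc (2 * k))    ≡⟨ cong suc (+-suc s (2 * k)) ⟩
    suc (suc (s + 2 * k))    ∎
    where open ≡-Reasoning

  half-shift : ∀ s k → ⌊ s + 2 * k /2⌋ ≡ ⌊ s /2⌋ + k
  half-shift s zero    = trans (cong ⌊_/2⌋ (+-identityʳ s)) (sym (+-identityʳ _))
  half-shift s (suc k) = begin
    ⌊ s + 2 * suc k /2⌋     ≡⟨ cong ⌊_/2⌋ (two-more s k) ⟩
    suc ⌊ s + 2 * k /2⌋     ≡⟨ cong suc (half-shift s k) ⟩
    suc (⌊ s /2⌋ + k)       ≡⟨ +-suc ⌊ s /2⌋ k ⟨
    ⌊ s /2⌋ + suc k         ∎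
    where open ≡-Reasoning

  parity-shift : ∀ s k → (s + 2 * k) % 2 ≡ s % 2
  parity-shift s k = trans (cong (λ t → (s + t) % 2) (*-comm 2 k)) ([m+kn]%n≡m%n s k 2)

  even+1 : ∀ s → testBit s 0 ≡ false → testBit (s + 1) 0 ≡ true × ⌊ s + 1 /2⌋ ≡ ⌊ s /2⌋
  even+1 zero          _    = refl , refl
  even+1 (suc (suc s)) even = proj₁ (even+1 s even) , cong suc (proj₂ (even+1 s even))

insertBit : ∀ a s x → testBit s a ≡ false → testBit (s + 2 ^ a) x ≡ ((x ≡ᵇ a) ∨ testBit s x)
insertBit zero    s zero    clear = proj₁ (even+1 s clear)
insertBit zero    s (suc x) clear = cong (λ t → testBit t x) (proj₂ (even+1 s clear))
insertBit (suc a) s zero    clear = cong (_≡ᵇ 1) (parity-shift s (2 ^ a))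
insertBit (suc a) s (suc x) clear =
  trans (cong (λ t → testBit t x) (half-shift s (2 ^ a))) (insertBit a ⌊ s /2⌋ x clear)

testBit-zero : ∀ x → testBit 0 x ≡ false
testBit-zero zero    = refl
testBit-zero (suc x) = testBit-zero x

infix 4 _∈ₕ_
record _∈ₕ_ (x y : HF) : Set where
  constructor bit
  field bit-set : T (mem x y)
open _∈ₕ_ public

-- Codes of elements are strictly smaller: the basis of all inductions on ∈.
∈ₕ⇒< : ∀ {x y} → x ∈ₕ y → x < y
∈ₕ⇒< {x} {y} (bit set) = <-≤-trans (n<2^n x) (bit⇒2^≤ y x set)

∉∅ : ∀ {x} → ¬ x ∈ₕ ∅
∉∅ {x} (bit set) = subst T (testBit-zero x) set

∈-insertS⁻ : ∀ {x a s} → x ∈ₕ insertS a s → x ≡ a ⊎ x ∈ₕ s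
∈-insertS⁻ {x} {a} {s} (bit set) with mem a s in present
... | true  = inj₂ (bit set)
... | false with Equivalence.to T-∨ (subst T (insertBit a s x present) set)
...   | inj₁ x≡a  = inj₁ (≡ᵇ⇒≡ x a x≡a)
...   | inj₂ x∈s  = inj₂ (bit x∈s)

∈-insertS⁺ : ∀ {x a s} → x ≡ a ⊎ x ∈ₕ s → x ∈ₕ insertS a s
∈-insertS⁺ {x} {a} {s} x∈ with mem a s in present
∈-insertS⁺ (inj₁ refl) | true = bit (subst T (sym present) _)
∈-insertS⁺ (inj₂ x∈s)  | true = x∈s
∈-insertS⁺ {x} {a} {s} x∈ | false =
  bit (subst T (sym (insertBit a s x present)) (Equivalence.from T-∨ (map⊎ (≡⇒≡ᵇ x a) bit-set x∈)))

∈-fromList⁻ : ∀ {x} L → x ∈ₕ fromList L → x ∈ L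
∈-fromList⁻ []      x∈ = ⊥-elim (∉∅ x∈)
∈-fromList⁻ (a ∷ L) x∈ with ∈-insertS⁻ x∈
... | inj₁ x≡a = here x≡a
... | inj₂ x∈L = there (∈-fromList⁻ L x∈L)

∈-fromList⁺ : ∀ {x} L → x ∈ L → x ∈ₕ fromList L
∈-fromList⁺ (a ∷ L) (here x≡a)  = ∈-insertS⁺ {s = fromList L} (inj₁ x≡a)
∈-fromList⁺ (a ∷ L) (there x∈L) = ∈-insertS⁺ {a = a} (inj₂ (∈-fromList⁺ L x∈L))

∈-elems⁻ : ∀ {x y} → x ∈ elems y → x ∈ₕ y
∈-elems⁻ {y = y} x∈ = bit (proj₂ (∈-filter⁻ (λ x → T? (mem x y)) {xs = upTo y} x∈))

∈-elems⁺ : ∀ {x y} → x ∈ₕ y → x ∈ elems y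
∈-elems⁺ x∈y = ∈-filter⁺ _ (∈-upTo⁺ (∈ₕ⇒< x∈y)) (bit-set x∈y)

elems-unique : ∀ y → Unique (elems y)
elems-unique y = Unique.filter⁺ _ (Unique.upTo⁺ y)

∈-∪⁻ : ∀ {x a b} → x ∈ₕ a ∪ b → x ∈ₕ a ⊎ x ∈ₕ b
∈-∪⁻ {a = a} {b} x∈ = map⊎ ∈-elems⁻ ∈-elems⁻ (∈-++⁻ (elems a) (∈-fromList⁻ (elems a ++ elems b) x∈))

∈-∪⁺ʳ : ∀ {x a b} → x ∈ₕ b → x ∈ₕ a ∪ b
∈-∪⁺ʳ {a = a} {b} x∈b = ∈-fromList⁺ (elems a ++ elems b) (∈-++⁺ʳ (elems a) (∈-elems⁺ x∈b))

∈-⋃⁻ : ∀ {x a} → x ∈ₕ ⋃ a → ∃ λ z → z ∈ₕ a × x ∈ₕ z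
∈-⋃⁻ {a = a} x∈ with find (∈-concatMap⁻ elems (∈-fromList⁻ (concatMap elems (elems a)) x∈))
... | z , z∈a , x∈z = z , ∈-elems⁻ z∈a , ∈-elems⁻ x∈z

∈-⋃⁺ : ∀ {x z a} → z ∈ₕ a → x ∈ₕ z → x ∈ₕ ⋃ a
∈-⋃⁺ {a = a} z∈a x∈z =
  ∈-fromList⁺ (concatMap elems (elems a)) (∈-concatMap⁺ elems (lose (∈-elems⁺ z∈a) (∈-elems⁺ x∈z)))

module _ {A : Set} where

  private
    ∈-─ : ∀ {x y : A} {ys} (x∈ys : x ∈ ys) → y ∈ ys → y ≢ x → y ∈ (ys ─ x∈ys)
    ∈-─ (here refl) (here refl)  y≢x = ⊥-elim (y≢x refl)
    ∈-─ (here refl) (there y∈ys) y≢x = y∈ys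
    ∈-─ (there x∈ys) (here y≡)   y≢x = here y≡
    ∈-─ (there x∈ys) (there y∈ys) y≢x = there (∈-─ x∈ys y∈ys y≢x)

  unique-length≤ : ∀ {xs ys : List A} → Unique xs → (∀ {y} → y ∈ xs → y ∈ ys) → length xs ≤ length ys
  unique-length≤ {[]}     _              _  = z≤n
  unique-length≤ {x ∷ xs} {ys} (x∉xs ∷ u) xs⊆ys = begin
    suc (length xs)              ≤⟨ s≤s (unique-length≤ u (λ y∈xs → ∈-─ x∈ys (xs⊆ys (there y∈xs)) (y≢x y∈xs))) ⟩
    suc (length (ys ─ x∈ys))     ≡⟨ length-removeAt′ ys (index x∈ys) ⟨
    length ys                    ∎
    where
    open ≤-Reasoning
    x∈ys : x ∈ ys
    x∈ys = xs⊆ys (here refl)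
    y≢x : ∀ {y} → y ∈ xs → y ≢ x
    y≢x y∈xs y≡x = All.lookup x∉xs y∈xs (sym y≡x)

card≤length : ∀ s L → (∀ {y} → y ∈ₕ s → y ∈ L) → card s ≤ length L
card≤length s L s⊆L = unique-length≤ (elems-unique s) (λ y∈ → s⊆L (∈-elems⁻ y∈))

-- Transitive membership: y ∈⁺ x says y ∈ TC(x), y ∈⁼ x says y ∈ {x} ∪ TC(x).
infix 4 _∈⁺_ _∈⁼_
data _∈⁺_ : HF → HF → Set where
  direct : ∀ {y x}   → y ∈ₕ x → y ∈⁺ x
  _◃_    : ∀ {y z x} → y ∈ₕ z → z ∈⁺ x → y ∈⁺ x

_∈⁼_ : HF → HF → Set
y ∈⁼ x = y ≡ x ⊎ y ∈⁺ x

⁺-trans : ∀ {y z x} → y ∈⁺ z → z ∈⁺ x → y ∈⁺ x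
⁺-trans (direct y∈z) z∈x = y∈z ◃ z∈x
⁺-trans (y∈w ◃ w∈z)  z∈x = y∈w ◃ ⁺-trans w∈z z∈x

⁼-⁺-trans : ∀ {y z x} → y ∈⁼ z → z ∈⁺ x → y ∈⁺ x
⁼-⁺-trans (inj₁ refl) z∈x = z∈x
⁼-⁺-trans (inj₂ y∈z)  z∈x = ⁺-trans y∈z z∈x

⁺-⁼-trans : ∀ {y z x} → y ∈⁺ z → z ∈⁼ x → y ∈⁺ x
⁺-⁼-trans y∈z (inj₁ refl) = y∈z
⁺-⁼-trans y∈z (inj₂ z∈x)  = ⁺-trans y∈z z∈x

⁼-trans : ∀ {y z x} → y ∈⁼ z → z ∈⁼ x → y ∈⁼ x
⁼-trans y∈z (inj₁ refl) = y∈z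
⁼-trans y∈z (inj₂ z∈x)  = inj₂ (⁼-⁺-trans y∈z z∈x)

⁺-top : ∀ {y x} → y ∈⁺ x → ∃ λ z → z ∈ₕ x × y ∈⁼ z
⁺-top (direct y∈x) = _ , y∈x , inj₁ refl
⁺-top (y∈w ◃ w∈x) with ⁺-top w∈x
... | z , z∈x , w∈z = z , z∈x , ⁼-trans (inj₂ (direct y∈w)) w∈z

-- Z^(r) consists of elements of TC(Z) at depth r + 1; this bounds r by Z.
∈-iterU⇒⁺ : ∀ r {y x} → y ∈ₕ iterU r x → y ∈⁺ x
∈-iterU⇒⁺ zero    y∈x = direct y∈x
∈-iterU⇒⁺ (suc r) y∈ with ∈-⋃⁻ y∈
... | z , z∈ , y∈z = y∈z ◃ ∈-iterU⇒⁺ r z∈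

∈-iterU-depth : ∀ r {y x} → y ∈ₕ iterU r x → r + y < x
∈-iterU-depth zero    y∈x = ∈ₕ⇒< y∈x
∈-iterU-depth (suc r) {y} y∈ with ∈-⋃⁻ y∈
... | z , z∈ , y∈z = ≤-<-trans (begin
  suc (r + y) ≡⟨ +-suc r y ⟨
  r + suc y   ≤⟨ +-monoʳ-≤ r (∈ₕ⇒< y∈z) ⟩
  r + z       ∎) (∈-iterU-depth r z∈)
  where open ≤-Reasoning

⁺⇒∈-iterU : ∀ {y x} → y ∈⁺ x → ∃ λ r → y ∈ₕ iterU r x
⁺⇒∈-iterU (direct y∈x) = zero , y∈x
⁺⇒∈-iterU (y∈z ◃ z∈x) with ⁺⇒∈-iterU z∈x
... | r , z∈ = suc r , ∈-⋃⁺ z∈ y∈z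

∈-TC⁻ : ∀ {y x} → y ∈ₕ TC x → y ∈⁺ x
∈-TC⁻ {x = x} y∈ with find (∈-concatMap⁻ (λ r → elems (iterU r x)) {xs = upTo (suc x)} (∈-fromList⁻ _ y∈))
... | r , _ , y∈r = ∈-iterU⇒⁺ r (∈-elems⁻ y∈r)

∈-TC⁺ : ∀ {y x} → y ∈⁺ x → y ∈ₕ TC x
∈-TC⁺ {y} {x} y∈x with ⁺⇒∈-iterU y∈x
... | r , y∈r = ∈-fromList⁺ _ (∈-concatMap⁺ (λ r → elems (iterU r x)) (lose r≤x (∈-elems⁺ y∈r)))
  where
  r≤x : r ∈ upTo (suc x)
  r≤x = ∈-upTo⁺ (s≤s (≤-trans (m≤m+n r y) (<⇒≤ (∈-iterU-depth r y∈r))))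

cT≤length : ∀ x L → (∀ {y} → y ∈⁺ x → y ∈ L) → cT x ≤ length L
cT≤length x L TC⊆L = card≤length (TC x) L (λ y∈ → TC⊆L (∈-TC⁻ y∈))

cT-mono : ∀ {w x} → w ∈⁼ x → cT w ≤ cT x
cT-mono {w} {x} w∈x = cT≤length w (elems (TC x)) (λ y∈w → ∈-elems⁺ (∈-TC⁺ (⁺-⁼-trans y∈w w∈x)))

sumᶠ : ∀ {k} → (Fin k → ℕ) → ℕ
sumᶠ {zero}  c = 0
sumᶠ {suc k} c = c zero + sumᶠ (c ∘ suc)

prodᶠ : ∀ {k} → (Fin k → ℕ) → ℕ
prodᶠ {zero}  c = 1
prodᶠ {suc k} c = c zero * prodᶠ (c ∘ suc)

concatᶠ : ∀ {A : Set} {k} → (Fin k → List A) → List A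
concatᶠ {k = zero}  G = []
concatᶠ {k = suc k} G = G zero ++ concatᶠ (G ∘ suc)

sumᶠ-mono : ∀ {k} {c d : Fin k → ℕ} → (∀ i → c i ≤ d i) → sumᶠ c ≤ sumᶠ d
sumᶠ-mono {zero}  c≤d = z≤n
sumᶠ-mono {suc k} c≤d = +-mono-≤ (c≤d zero) (sumᶠ-mono (c≤d ∘ suc))

sumᶠ-strict : ∀ {k} {c d : Fin k → ℕ} → (∀ i → c i ≤ d i) → ∀ i → c i < d i → sumᶠ c < sumᶠ d
sumᶠ-strict c≤d zero    c<d = +-mono-<-≤ c<d (sumᶠ-mono (c≤d ∘ suc))
sumᶠ-strict c≤d (suc i) c<d = +-mono-≤-< (c≤d zero) (sumᶠ-strict (c≤d ∘ suc) i c<d)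

∈-concatᶠ⁺ : ∀ {A : Set} {k} (G : Fin k → List A) i {y} → y ∈ G i → y ∈ concatᶠ G
∈-concatᶠ⁺ G zero    y∈ = ∈-++⁺ˡ y∈
∈-concatᶠ⁺ G (suc i) y∈ = ∈-++⁺ʳ (G zero) (∈-concatᶠ⁺ (G ∘ suc) i y∈)

length-concatᶠ≤ : ∀ {A : Set} {k} (G : Fin k → List A) {c : Fin k → ℕ} →
                  (∀ i → length (G i) ≤ c i) → length (concatᶠ G) ≤ sumᶠ c
length-concatᶠ≤ {k = zero}  G bound = z≤n
length-concatᶠ≤ {k = suc k} G {c} bound = begin
  length (G zero ++ concatᶠ (G ∘ suc))           ≡⟨ length-++ (G zero) ⟩
  length (G zero) + length (concatᶠ (G ∘ suc))   ≤⟨ +-mono-≤ (bound zero) (length-concatᶠ≤ (G ∘ suc) (bound ∘ suc)) ⟩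
  sumᶠ c ∎
  where open ≤-Reasoning

length-concatMap≤ : ∀ {A B : Set} (G : A → List B) (L : List A) {b} →
                    (∀ {w} → w ∈ L → length (G w) ≤ b) → length (concatMap G L) ≤ length L * b
length-concatMap≤ G []      bound = z≤n
length-concatMap≤ G (w ∷ L) {b} bound = begin
  length (G w ++ concatMap G L)           ≡⟨ length-++ (G w) ⟩
  length (G w) + length (concatMap G L)   ≤⟨ +-mono-≤ (bound (here refl)) (length-concatMap≤ G L (bound ∘ there)) ⟩
  length (w ∷ L) * b ∎
  where open ≤-Reasoning

evalP-mono : ∀ {n} (p : Poly n) {v w : Vector ℕ n} → (∀ i → v i ≤ w i) → evalP p v ≤ evalP p w
evalP-mono (const c) v≤w = ≤-refl
evalP-mono (var i)   v≤w = v≤w i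
evalP-mono (p ⊕ q)   v≤w = +-mono-≤ (evalP-mono p v≤w) (evalP-mono q v≤w)
evalP-mono (p ⊗ q)   v≤w = *-mono-≤ (evalP-mono p v≤w) (evalP-mono q v≤w)

substP : ∀ {k n} → Poly k → (Fin k → Poly n) → Poly n
substP (const c) σ = const c
substP (var i)   σ = σ i
substP (p ⊕ q)   σ = substP p σ ⊕ substP q σ
substP (p ⊗ q)   σ = substP p σ ⊗ substP q σ

evalP-substP : ∀ {k n} (p : Poly k) (σ : Fin k → Poly n) v → evalP (substP p σ) v ≡ evalP p (λ i → evalP (σ i) v)
evalP-substP (const c) σ v = refl
evalP-substP (var i)   σ v = refl
evalP-substP (p ⊕ q)   σ v = cong₂ _+_ (evalP-substP p σ v) (evalP-substP q σ v)
evalP-substP (p ⊗ q)   σ v = cong₂ _*_ (evalP-substP p σ v) (evalP-substP q σ v)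

sumP : ∀ {k n} → (Fin k → Poly n) → Poly n
sumP {zero}  ps = const 0
sumP {suc k} ps = ps zero ⊕ sumP (ps ∘ suc)

evalP-sumP : ∀ {k n} (ps : Fin k → Poly n) v → evalP (sumP ps) v ≡ sumᶠ (λ i → evalP (ps i) v)
evalP-sumP {zero}  ps v = refl
evalP-sumP {suc k} ps v = cong (evalP (ps zero) v +_) (evalP-sumP (ps ∘ suc) v)

prodP : ∀ {k n} → (Fin k → Poly n) → Poly n
prodP {zero}  ps = const 1
prodP {suc k} ps = ps zero ⊗ prodP (ps ∘ suc)

evalP-prodP : ∀ {k n} (ps : Fin k → Poly n) v → evalP (prodP ps) v ≡ prodᶠ (λ i → evalP (ps i) v)
evalP-prodP {zero}  ps v = refl
evalP-prodP {suc k} ps v = cong (evalP (ps zero) v *_) (evalP-prodP (ps ∘ suc) v)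

sum-of-vars-monotonic : ∀ {n} (p : Poly n) → Monotonic (sumP var ⊕ p)
sum-of-vars-monotonic p v i y v<y = +-mono-<-≤
  (begin-strict
    evalP (sumP var) v  ≡⟨ evalP-sumP var v ⟩
    sumᶠ v              <⟨ sumᶠ-strict v≤w i (subst (v i <_) (sym (updateAt-updates i v)) v<y) ⟩
    sumᶠ w              ≡⟨ evalP-sumP var w ⟨
    evalP (sumP var) w  ∎)
  (evalP-mono p v≤w)
  where
  open ≤-Reasoning
  w : Vector ℕ _
  w = updateAt v i (λ _ → y)
  v≤w : ∀ j → v j ≤ w j
  v≤w j with i Fin.≟ j
  ... | yes refl = ≤-trans (<⇒≤ v<y) (≤-reflexive (sym (updateAt-updates i v)))
  ... | no  i≢j  = ≤-reflexive (sym (updateAt-minimal j i v (i≢j ∘ sym)))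

∈-tuples⁻ : ∀ {A : Set} n (L : Fin n → List A) {X} → X ∈ tuples n L → ∀ i → X i ∈ L i
∈-tuples⁻ (suc n) L X∈ i with find (∈-concatMap⁻ (λ a → map (a V.∷_) (tuples n (V.tail L))) {xs = L zero} X∈)
... | a , a∈ , X∈′ with ∈-map⁻ (a V.∷_) X∈′
... | X′ , X′∈ , refl with i
... | zero   = a∈
... | suc i′ = ∈-tuples⁻ n (V.tail L) X′∈ i′

length-tuples≤ : ∀ {A : Set} n (L : Fin n → List A) {b : Fin n → ℕ} →
                 (∀ i → length (L i) ≤ b i) → length (tuples n L) ≤ prodᶠ b
length-tuples≤ zero    L bound = ≤-refl
length-tuples≤ (suc n) L {b} bound = begin
  length (concatMap (λ a → map (a V.∷_) rest) (L zero))  ≤⟨ length-concatMap≤ _ (L zero) (λ {a} _ → rest≤ a) ⟩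
  length (L zero) * prodᶠ (b ∘ suc)                      ≤⟨ *-monoˡ-≤ _ (bound zero) ⟩
  prodᶠ b ∎
  where
  open ≤-Reasoning
  rest : List (Vector _ n)
  rest = tuples n (V.tail L)
  rest≤ : ∀ a → length (map (a V.∷_) rest) ≤ prodᶠ (b ∘ suc)
  rest≤ a = ≤-trans (≤-reflexive (length-map (a V.∷_) rest)) (length-tuples≤ n (V.tail L) (bound ∘ suc))

box-∈⁺ : ∀ {n} (Z : Vector HF n) α {X} → X ∈ box Z α → ∀ i → X i ∈⁺ Z i
box-∈⁺ {n} Z α X∈ i = ∈-iterU⇒⁺ (α i) (∈-elems⁻ (∈-tuples⁻ n _ X∈ i))

-- |Z⃗^(α)| ≤ ∏ cT(Z_i), since Z_i^(α_i) ⊆ TC(Z_i).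
length-box≤ : ∀ {n} (Z : Vector HF n) α → length (box Z α) ≤ prodᶠ (λ i → cT (Z i))
length-box≤ {n} Z α = length-tuples≤ n _ λ i →
  card≤length (iterU (α i) (Z i)) (elems (TC (Z i))) (λ y∈ → ∈-elems⁺ (∈-TC⁺ (∈-iterU⇒⁺ (α i) y∈)))

-- The possible origins of an element y of {F(x⃗/a⃗)} ∪ TC(F(x⃗/a⃗)): it lies in the
-- closure of a normal argument, in the closure of a safe argument, or it is one
-- of the sets in a list N of newly built sets.
data Source {n m} (xs : Vector HF n) (as : Vector HF m) (N : List HF) (y : HF) : Set where
  normal : (i : Fin n) → y ∈⁼ xs i → Source xs as N y
  safe   : (j : Fin m) → y ∈⁼ as j → Source xs as N y
  new    : y ∈ N → Source xs as N y

-- F is covered within `bound` if the new sets in the closure of F(x⃗/a⃗) fit in a list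
-- whose length is bounded by `bound x⃗`, independently of the safe arguments a⃗.
record Covered {n m} (F : Vector HF n → Vector HF m → HF) (bound : Vector HF n → ℕ) : Set where
  field
    newSets  : Vector HF n → Vector HF m → List HF
    newSets≤ : ∀ xs as → length (newSets xs as) ≤ bound xs
    covers   : ∀ xs as {y} → y ∈⁼ F xs as → Source xs as (newSets xs as) y
open Covered

source-below : ∀ {n m} {xs : Vector HF n} {as : Vector HF m} {N y z} →
               y ∈⁼ z → Source xs as [] z → Source xs as N y
source-below y∈z (normal i z∈) = normal i (⁼-trans y∈z z∈)
source-below y∈z (safe j z∈)   = safe j (⁼-trans y∈z z∈)

source-compose : ∀ {n m k l} {xs : Vector HF n} {as : Vector HF m} {us : Vector HF k} {vs : Vector HF l}
                   {N L y} →
                 (∀ i {y} → y ∈⁼ us i → Source xs as L y) →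
                 (∀ j {y} → y ∈⁼ vs j → Source xs as L y) →
                 (∀ {y} → y ∈ N → y ∈ L) →
                 Source us vs N y → Source xs as L y
source-compose viaU viaV N⊆L (normal i y∈) = viaU i y∈
source-compose viaU viaV N⊆L (safe j y∈)   = viaV j y∈
source-compose viaU viaV N⊆L (new y∈N)     = new (N⊆L y∈N)

covered-by-argument : ∀ {n m} {F : Vector HF n → Vector HF m → HF} →
                      (∀ xs as → Source xs as [] (F xs as)) → Covered F (λ _ → 0)
covered-by-argument isArg = record
  { newSets  = λ _ _ → []
  ; newSets≤ = λ _ _ → z≤n
  ; covers   = λ xs as y∈ → source-below y∈ (isArg xs as)
  }

-- A value whose members all lie in the closures of the safe arguments creates
-- at most one new set: the value itself.
covered-by-members : ∀ {n m} {F : Vector HF n → Vector HF m → HF} →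
                     (∀ xs as {z} → z ∈ₕ F xs as → ∃ λ j → z ∈⁼ as j) → Covered F (λ _ → 1)
covered-by-members {F = F} membersOld = record
  { newSets  = λ xs as → F xs as ∷ []
  ; newSets≤ = λ _ _ → ≤-refl
  ; covers   = cover
  }
  where
  cover : ∀ xs as {y} → y ∈⁼ F xs as → Source xs as (F xs as ∷ []) y
  cover xs as (inj₁ refl) = new (here refl)
  cover xs as (inj₂ y∈F) with ⁺-top y∈F
  ... | z , z∈F , y∈z with membersOld xs as z∈F
  ... | j , z∈a = safe j (⁼-trans y∈z z∈a)

closures : ∀ {n} → Vector HF n → List HF
closures xs = concatᶠ (λ i → xs i ∷ elems (TC (xs i)))

∈-closures : ∀ {n} (xs : Vector HF n) i {y} → y ∈⁼ xs i → y ∈ closures xs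
∈-closures xs i (inj₁ refl) = ∈-concatᶠ⁺ (λ i → xs i ∷ elems (TC (xs i))) i (here refl)
∈-closures xs i (inj₂ y∈)   = ∈-concatᶠ⁺ (λ i → xs i ∷ elems (TC (xs i))) i (there (∈-elems⁺ (∈-TC⁺ y∈)))

length-closures≤ : ∀ {n} (xs : Vector HF n) → length (closures xs) ≤ sumᶠ (λ i → suc (cT (xs i)))
length-closures≤ xs = length-concatᶠ≤ (λ i → xs i ∷ elems (TC (xs i))) (λ i → ≤-refl)

cT-covered≤ : ∀ {n} {F : Vector HF n → Vector HF 0 → HF} {bound} → Covered F bound →
              ∀ xs as → cT (F xs as) ≤ sumᶠ (λ i → suc (cT (xs i))) + bound xs
cT-covered≤ {F = F} {bound} cov xs as = begin
  cT (F xs as)                                 ≤⟨ cT≤length (F xs as) (closures xs ++ N) TC⊆ ⟩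
  length (closures xs ++ N)                     ≡⟨ length-++ (closures xs) ⟩
  length (closures xs) + length N               ≤⟨ +-mono-≤ (length-closures≤ xs) (newSets≤ cov xs as) ⟩
  sumᶠ (λ i → suc (cT (xs i))) + bound xs ∎
  where
  open ≤-Reasoning
  N : List HF
  N = newSets cov xs as
  TC⊆ : ∀ {y} → y ∈⁺ F xs as → y ∈ closures xs ++ N
  TC⊆ y∈ with covers cov xs as (inj₂ y∈)
  ... | normal i y∈x = ∈-++⁺ˡ (∈-closures xs i y∈x)
  ... | new y∈N      = ∈-++⁺ʳ (closures xs) y∈N

covered-weaken : ∀ {n m} {F : Vector HF n → Vector HF m → HF} {b b′ : Vector HF n → ℕ} →
                 (∀ xs → b xs ≤ b′ xs) → Covered F b → Covered F b′
covered-weaken b≤b′ cov = record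
  { newSets  = newSets cov
  ; newSets≤ = λ xs as → ≤-trans (newSets≤ cov xs as) (b≤b′ xs)
  ; covers   = covers cov
  }

module _ {n m k l} {H : Vector HF k → Vector HF l → HF} {bH : Vector HF k → ℕ}
         {R : Fin k → Vector HF n → Vector HF 0 → HF} {bR : Fin k → Vector HF n → ℕ}
         {T : Fin l → Vector HF n → Vector HF m → HF} {bT : Fin l → Vector HF n → ℕ}
         (covH : Covered H bH) (covR : ∀ i → Covered (R i) (bR i)) (covT : ∀ j → Covered (T j) (bT j))
         where

  private
    Rs : Vector HF n → Vector HF k
    Rs xs i = R i xs (λ ())

    Ts : Vector HF n → Vector HF m → Vector HF l
    Ts xs as j = T j xs as

    newRᵢ : Vector HF n → Fin k → List HF
    newRᵢ xs i = newSets (covR i) xs (λ ())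

    newR : Vector HF n → List HF
    newR xs = concatᶠ (newRᵢ xs)

    newT : Vector HF n → Vector HF m → List HF
    newT xs as = concatᶠ (λ j → newSets (covT j) xs as)

    newH : Vector HF n → Vector HF m → List HF
    newH xs as = newSets covH (Rs xs) (Ts xs as)

  covered-compose : Covered (λ xs as → H (Rs xs) (Ts xs as))
                            (λ xs → bH (Rs xs) + (sumᶠ (λ i → bR i xs) + sumᶠ (λ j → bT j xs)))
  covered-compose = record
    { newSets  = λ xs as → newH xs as ++ (newR xs ++ newT xs as)
    ; newSets≤ = length≤
    ; covers   = λ xs as y∈ → source-compose (viaR xs as) (viaT xs as) ∈-++⁺ˡ (covers covH (Rs xs) (Ts xs as) y∈)
    }
    where
    length≤ : ∀ xs as → length (newH xs as ++ (newR xs ++ newT xs as))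
                          ≤ bH (Rs xs) + (sumᶠ (λ i → bR i xs) + sumᶠ (λ j → bT j xs))
    length≤ xs as = begin
      length (newH xs as ++ (newR xs ++ newT xs as))               ≡⟨ length-++ (newH xs as) ⟩
      length (newH xs as) + length (newR xs ++ newT xs as)         ≡⟨ cong (length (newH xs as) +_) (length-++ (newR xs)) ⟩
      length (newH xs as) + (length (newR xs) + length (newT xs as))
        ≤⟨ +-mono-≤ (newSets≤ covH (Rs xs) (Ts xs as))
                    (+-mono-≤ (length-concatᶠ≤ (newRᵢ xs) (λ i → newSets≤ (covR i) xs (λ ())))
                              (length-concatᶠ≤ _ (λ j → newSets≤ (covT j) xs as))) ⟩
      bH (Rs xs) + (sumᶠ (λ i → bR i xs) + sumᶠ (λ j → bT j xs)) ∎
      where open ≤-Reasoning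

    viaR : ∀ xs as i {y} → y ∈⁼ Rs xs i → Source xs as (newH xs as ++ (newR xs ++ newT xs as)) y
    viaR xs as i y∈ = source-compose (λ i → normal i) (λ ())
      (λ y∈N → ∈-++⁺ʳ (newH xs as) (∈-++⁺ˡ (∈-concatᶠ⁺ (newRᵢ xs) i y∈N)))
      (covers (covR i) xs (λ ()) y∈)

    viaT : ∀ xs as j {y} → y ∈⁼ Ts xs as j → Source xs as (newH xs as ++ (newR xs ++ newT xs as)) y
    viaT xs as j y∈ = source-compose (λ i → normal i) (λ j → safe j)
      (λ y∈N → ∈-++⁺ʳ (newH xs as) (∈-++⁺ʳ (newR xs) (∈-concatᶠ⁺ (λ j → newSets (covT j) xs as) j y∈N)))
      (covers (covT j) xs as y∈)

pair-members : ∀ {as : Vector HF 2} {z} → z ∈ₕ eval⁻ pair⁻ as → ∃ λ j → z ∈⁼ as j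
pair-members {as} z∈ with ∈-fromList⁻ (as zero ∷ as (suc zero) ∷ []) z∈
... | here refl         = zero , inj₁ refl
... | there (here refl) = suc zero , inj₁ refl

union-members : ∀ {as : Vector HF 1} {z} → z ∈ₕ eval⁻ union⁻ as → ∃ λ j → z ∈⁼ as j
union-members z∈ with ∈-⋃⁻ z∈
... | w , w∈a , z∈w = zero , inj₂ (z∈w ◃ direct w∈a)

-- Separation only selects members of its last argument.
sep-members : ∀ {m} (h : PCSF⁻ (suc m)) {as : Vector HF (suc m)} {z} →
              z ∈ₕ eval⁻ (sep⁻ h) as → ∃ λ j → z ∈⁼ as j
sep-members {m} h {as} {z} z∈ = fromℕ m , inj₂ (direct (∈-elems⁻ (proj₁ (∈-filter⁻ (λ b → T? (keep b)) z∈L))))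
  where
  keep : HF → Bool
  keep b = not (eval⁻ h (snoc (initV as) b) ≡ᵇ 0)
  z∈L : z ∈ filterᵇ keep (elems (lastV as))
  z∈L = ∈-fromList⁻ (filterᵇ keep (elems (lastV as))) z∈

cond-argument : ∀ (xs : Vector HF 0) as → Source xs as [] (eval⁻ cond⁻ as)
cond-argument xs as with mem (as (suc (suc zero))) (as (suc (suc (suc zero))))
... | true  = safe zero (inj₁ refl)
... | false = safe (suc zero) (inj₁ refl)

covered⁻ : ∀ {m} (h : PCSF⁻ m) → Σ ℕ λ c → Covered {0} (λ _ → eval⁻ h) (λ _ → c)
covered⁻ (proj⁻ j)   = 0 , covered-by-argument (λ _ _ → safe j (inj₁ refl))
covered⁻ pair⁻       = 1 , covered-by-members (λ _ _ → pair-members)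
covered⁻ null⁻       = 1 , covered-by-members (λ _ _ z∈ → ⊥-elim (∉∅ z∈))
covered⁻ union⁻      = 1 , covered-by-members (λ _ _ → union-members)
covered⁻ cond⁻       = 0 , covered-by-argument cond-argument
covered⁻ (sep⁻ h)    = 1 , covered-by-members (λ _ _ → sep-members h)
covered⁻ (comp⁻ h t) = proj₁ (covered⁻ h) + sumᶠ (proj₁ ∘ covered⁻ ∘ t) ,
  covered-compose {R = λ ()} {bR = λ ()} (proj₂ (covered⁻ h)) (λ ()) (proj₂ ∘ covered⁻ ∘ t)

boundBy : ∀ {n} → Poly n → Vector HF n → ℕ
boundBy p xs = evalP p (λ i → cT (xs i))

∈⁼-snoc : ∀ {m} (as : Vector HF m) x j {y} → y ∈⁼ snoc as x j → y ∈⁼ x ⊎ ∃ λ j′ → y ∈⁼ as j′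
∈⁼-snoc {zero}  as x zero    y∈ = inj₁ y∈
∈⁼-snoc {suc m} as x zero    y∈ = inj₂ (zero , y∈)
∈⁼-snoc {suc m} as x (suc j) y∈ with ∈⁼-snoc (V.tail as) x j y∈
... | inj₁ y∈x         = inj₁ y∈x
... | inj₂ (j′ , y∈a)  = inj₂ (suc j′ , y∈a)

self+TC : HF → List HF
self+TC z = z ∷ elems (TC z)

∈-self+TC⁻ : ∀ {w z} → w ∈ self+TC z → w ∈⁼ z
∈-self+TC⁻ (here refl) = inj₁ refl
∈-self+TC⁻ (there w∈)  = inj₂ (∈-TC⁻ (∈-elems⁻ w∈))

∈-self+TC⁺ : ∀ {w z} → w ∈⁼ z → w ∈ self+TC z
∈-self+TC⁺ (inj₁ refl) = here refl
∈-self+TC⁺ (inj₂ w∈z)  = there (∈-elems⁺ (∈-TC⁺ w∈z))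

-- Predicative set recursion f(z, y⃗/a⃗) = h(z, y⃗/a⃗, R(z)) with R(z) = {f(w, y⃗/a⃗) : w ∈ z},
-- for fixed y⃗, a⃗.  The new sets in the closure of f(z, y⃗/a⃗) are, for each
-- w ∈ {z} ∪ TC(z), the set R(w) together with the new sets of h at (w, y⃗/a⃗, R(w)):
-- at most (1 + cT(z)) · (1 + p_h(cT(z), cT(y⃗))) many.
module Recursion {n m} (h : PCSF (suc n) (suc m)) (p : Poly (suc n)) (covh : Covered (eval h) (boundBy p))
                 (ys : Vector HF n) (as : Vector HF m) where

  F : HF → HF
  F z = recAux h (suc z) z ys as

  R : HF → HF
  R z = fromList (map F (elems z))

  -- Any fuel exceeding z computes the same value at z, since members have smaller codes.
  fuel-irrelevant : ∀ j j′ z → z < j → z < j′ → recAux h j z ys as ≡ recAux h j′ z ys as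
  fuel-irrelevant (suc j) (suc j′) z (s≤s z≤j) (s≤s z≤j′) =
    cong (λ L → eval h (z V.∷ ys) (snoc as (fromList L)))
      (map-cong-local (All.tabulate λ w∈z → let w<z = ∈ₕ⇒< (∈-elems⁻ w∈z) in
        fuel-irrelevant j j′ _ (≤-trans w<z z≤j) (≤-trans w<z z≤j′)))

  F-unfold : ∀ z → F z ≡ eval h (z V.∷ ys) (snoc as (R z))
  F-unfold z = cong (λ L → eval h (z V.∷ ys) (snoc as (fromList L)))
    (map-cong-local (All.tabulate λ w∈z → fuel-irrelevant z (suc _) _ (∈ₕ⇒< (∈-elems⁻ w∈z)) ≤-refl))

  newAt : HF → List HF
  newAt w = R w ∷ newSets covh (w V.∷ ys) (snoc as (R w))

  newBelow : HF → List HF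
  newBelow z = concatMap newAt (self+TC z)

  newBelow-mono : ∀ {w z y} → w ∈ₕ z → y ∈ newBelow w → y ∈ newBelow z
  newBelow-mono {w} w∈z y∈ with find (∈-concatMap⁻ newAt {xs = self+TC w} y∈)
  ... | v , v∈ , y∈v = ∈-concatMap⁺ newAt (lose (∈-self+TC⁺ (inj₂ (⁼-⁺-trans (∈-self+TC⁻ v∈) (direct w∈z)))) y∈v)

  R∈newBelow : ∀ z → R z ∈ newBelow z
  R∈newBelow z = here refl

  hNew⊆newBelow : ∀ z {y} → y ∈ newSets covh (z V.∷ ys) (snoc as (R z)) → y ∈ newBelow z
  hNew⊆newBelow z y∈ = there (∈-++⁺ˡ y∈)

  F-covers : ∀ z → Acc _<_ z → ∀ {y} → y ∈⁼ F z → Source (z V.∷ ys) as (newBelow z) y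
  F-covers z (acc below) {y} y∈ with covers covh (z V.∷ ys) (snoc as (R z)) (subst (y ∈⁼_) (F-unfold z) y∈)
  ... | normal i y∈x = normal i y∈x
  ... | new y∈N      = new (hNew⊆newBelow z y∈N)
  ... | safe j y∈a with ∈⁼-snoc as (R z) j y∈a
  ...   | inj₂ (j′ , y∈a′) = safe j′ y∈a′
  ...   | inj₁ (inj₁ refl) = new (R∈newBelow z)
  ...   | inj₁ (inj₂ y∈R) with ⁺-top y∈R
  ...     | u , u∈R , y∈u with ∈-map⁻ F (∈-fromList⁻ (map F (elems z)) u∈R)
  ...       | w , w∈z , refl =
    source-compose (λ { zero y∈w → normal zero (⁼-trans y∈w (inj₂ (direct (∈-elems⁻ w∈z))))
                      ; (suc i) y∈x → normal (suc i) y∈x })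
                   (λ j y∈a′ → safe j y∈a′) (newBelow-mono (∈-elems⁻ w∈z))
                   (F-covers w (below (∈ₕ⇒< (∈-elems⁻ w∈z))) y∈u)

  length-newBelow≤ : ∀ z → length (newBelow z) ≤ suc (cT z) * suc (boundBy p (z V.∷ ys))
  length-newBelow≤ z = length-concatMap≤ newAt (self+TC z) λ {w} w∈ →
    s≤s (≤-trans (newSets≤ covh (w V.∷ ys) (snoc as (R w)))
                 (evalP-mono p λ { zero → cT-mono (∈-self+TC⁻ w∈) ; (suc i) → ≤-refl }))

PolyCovered : ∀ {n m} → PCSF n m → Set
PolyCovered {n} f = Σ (Poly n) λ p → Covered (eval f) (boundBy p)

projection-argument : ∀ {n m} (j : Fin (n + m)) xs as → Source xs as [] ((xs V.++ as) j)
projection-argument {n} {m} j xs as = by-block (Fin.splitAt n j)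
  where
  by-block : (b : Fin n ⊎ Fin m) → Source xs as [] ([ xs , as ] b)
  by-block (inj₁ i) = normal i (inj₁ refl)
  by-block (inj₂ k) = safe k (inj₁ refl)

-- Σ_i (1 + x_i): bounds the closure of the normal arguments.
argumentsP : ∀ {n} → Poly n
argumentsP = sumP (λ i → const 1 ⊕ var i)

-- For safe composition, the bound of h is evaluated at the sizes of the values
-- r_i(x⃗/-), which are in turn polynomially bounded by `cT-covered≤`.
covered-scomp : ∀ {n m k l} (h : PCSF k l) (r : Fin k → PCSF n 0) (t : Fin l → PCSF n m) →
                PolyCovered h → (∀ i → PolyCovered (r i)) → (∀ j → PolyCovered (t j)) →
                PolyCovered (scomp h r t)
covered-scomp {n} {m} {k} {l} h r t (ph , covh) covr covt =
  substP ph σ ⊕ (sumP pr ⊕ sumP pt) ,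
  covered-weaken bound≤ (covered-compose {R = λ i → eval (r i)} {T = λ j → eval (t j)} covh (proj₂ ∘ covr) (proj₂ ∘ covt))
  where
  pr : Fin k → Poly n
  pr = proj₁ ∘ covr
  pt : Fin l → Poly n
  pt = proj₁ ∘ covt
  σ : Fin k → Poly n
  σ i = argumentsP ⊕ pr i

  cT-r≤ : ∀ xs i → cT (eval (r i) xs (λ ())) ≤ evalP (σ i) (λ i → cT (xs i))
  cT-r≤ xs i = ≤-trans (cT-covered≤ (proj₂ (covr i)) xs (λ ()))
    (+-monoˡ-≤ _ (≤-reflexive (sym (evalP-sumP (λ i → const 1 ⊕ var i) (λ i → cT (xs i))))))

  bound≤ : ∀ xs → boundBy ph (λ i → eval (r i) xs (λ ())) + (sumᶠ (λ i → boundBy (pr i) xs) + sumᶠ (λ j → boundBy (pt j) xs))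
                  ≤ boundBy (substP ph σ ⊕ (sumP pr ⊕ sumP pt)) xs
  bound≤ xs = +-mono-≤
    (≤-trans (evalP-mono ph (cT-r≤ xs)) (≤-reflexive (sym (evalP-substP ph σ _))))
    (≤-reflexive (sym (cong₂ _+_ (evalP-sumP pr _) (evalP-sumP pt _))))

covered-rec : ∀ {n m} (h : PCSF (suc n) (suc m)) → PolyCovered h → PolyCovered (rec h)
covered-rec {n} h (p , covh) = (const 1 ⊕ var zero) ⊗ (const 1 ⊕ p) , record
  { newSets  = λ xs as → Recursion.newBelow h p covh (V.tail xs) as (V.head xs)
  ; newSets≤ = λ xs as → ≤-trans (Recursion.length-newBelow≤ h p covh (V.tail xs) as (V.head xs))
                                 (*-monoʳ-≤ (suc (cT (V.head xs))) (s≤s (evalP-mono p (head∷tail≤ {xs}))))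
  ; covers   = λ xs as y∈ → source-compose head∷tail-source (λ j → safe j) (λ y∈N → y∈N)
                 (Recursion.F-covers h p covh (V.tail xs) as (V.head xs) (<-wellFounded _) y∈)
  }
  where
  head∷tail≤ : ∀ {xs : Vector HF (suc n)} i → cT ((V.head xs V.∷ V.tail xs) i) ≤ cT (xs i)
  head∷tail≤ zero    = ≤-refl
  head∷tail≤ (suc i) = ≤-refl

  head∷tail-source : ∀ {xs : Vector HF (suc n)} {m} {as : Vector HF m} {N} i {y} →
                     y ∈⁼ (V.head xs V.∷ V.tail xs) i → Source xs as N y
  head∷tail-source zero    y∈ = normal zero y∈
  head∷tail-source (suc i) y∈ = normal (suc i) y∈

covered : ∀ {n m} (f : PCSF n m) → PolyCovered f
covered (minus h)     = const (proj₁ (covered⁻ h)) , proj₂ (covered⁻ h)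
covered (proj j)      = const 0 , covered-by-argument (projection-argument j)
covered (scomp h r t) = covered-scomp h r t (covered h) (covered ∘ r) (covered ∘ t)
covered (rec h)       = covered-rec h (covered h)

cT-∪≤ : ∀ a s (L : List HF) → (∀ {y} → y ∈⁺ a ∪ s → y ∈⁺ a ⊎ y ∈ L) → cT (a ∪ s) ≤ length L + cT a
cT-∪≤ a s L TC⊆ = begin
  cT (a ∪ s)                      ≤⟨ cT≤length (a ∪ s) (L ++ elems (TC a)) (λ y∈ → [ old , ∈-++⁺ˡ ] (TC⊆ y∈)) ⟩
  length (L ++ elems (TC a))      ≡⟨ length-++ L ⟩
  length L + cT a                 ∎
  where
  open ≤-Reasoning
  old : ∀ {y} → y ∈⁺ a → y ∈ L ++ elems (TC a)
  old y∈a = ∈-++⁺ʳ L (∈-elems⁺ (∈-TC⁺ y∈a))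

∈-Sg⁺ : ∀ {n m k} (Z : Vector HF n) (g : Fin m → PCSF n k) A αg j {X w} →
        X ∈ box Z (αg j) → w ∈ₕ eval (g j) X A → w ∈ₕ Sg Z g A αg
∈-Sg⁺ {m = m} Z g A αg j X∈ w∈ = ∈-fromList⁺ _
  (∈-concatMap⁺ _ {xs = allFin m} (lose (∈-allFin j) (∈-concatMap⁺ _ (lose X∈ (∈-elems⁺ w∈)))))

∈-Sf⁻ : ∀ {n m k ℓ} (Z : Vector HF n) (f : Fin ℓ → PCSF n m) (g : Fin m → PCSF n k) A αg αf {z} →
        z ∈ₕ Sf Z f g A αg αf →
        ∃ λ i → ∃ λ Xf → ∃ λ Xg → Xf ∈ box Z (αf i) × Xg ∈ tuples m (λ j → box Z (αg j)) ×
          z ∈ₕ eval (f i) Xf (λ j → eval (g j) (Xg j) A)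
∈-Sf⁻ {m = m} {ℓ = ℓ} Z f g A αg αf z∈
  with find (∈-concatMap⁻ _ {xs = allFin ℓ} (∈-fromList⁻ _ z∈))
... | i , _ , z∈i with find (∈-concatMap⁻ _ {xs = box Z (αf i)} z∈i)
... | Xf , Xf∈ , z∈Xf with find (∈-concatMap⁻ _ {xs = tuples m (λ j → box Z (αg j))} z∈Xf)
... | Xg , Xg∈ , z∈Xg = i , Xf , Xg , Xf∈ , Xg∈ , ∈-elems⁻ z∈Xg

-- The polynomial of Lemma 5.3 for f_1,…,f_ℓ with covering polynomials p_1,…,p_ℓ:
--   Σ_i x_i                             bounding the closures TC(Z_i),
--   m · ∏_i x_i                         bounding the values g_j(X⃗/A⃗) themselves,
--   Σ_i ∏ x⃗ · (∏ x⃗)^m · p_i(x⃗)          bounding the new sets created by the f_i.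
boxP : ∀ {n} → Poly n
boxP = prodP var

valuesAndNewP : ∀ {n} m {ℓ} → (Fin ℓ → Poly n) → Poly n
valuesAndNewP m ps = sumP {m} (λ _ → boxP) ⊕ sumP (λ i → boxP ⊗ (prodP {m} (λ _ → boxP) ⊗ ps i))

lemmaP : ∀ {n} m {ℓ} → (Fin ℓ → Poly n) → Poly n
lemmaP m ps = sumP var ⊕ valuesAndNewP m ps

module Lemma5p3 {n m ℓ k} (f : Fin ℓ → PCSF n m) (Z : Vector HF n) (g : Fin m → PCSF n k) (A : Vector HF k)
                (B : HF) (αg : Fin m → Vector ℕ n) (αf : Fin ℓ → Vector ℕ n) where

  sizes : Vector ℕ n
  sizes i = cT (Z i)

  ps : Fin ℓ → Poly n
  ps = proj₁ ∘ covered ∘ f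

  covf : ∀ i → Covered (eval (f i)) (boundBy (ps i))
  covf i = proj₂ (covered (f i))

  Base : HF
  Base = (B ∪ ⋃ᵥ A) ∪ Sg Z g A αg

  gValue : Vector (Vector HF n) m → Vector HF m
  gValue Xg j = eval (g j) (Xg j) A

  gTuples : List (Vector (Vector HF n) m)
  gTuples = tuples m (λ j → box Z (αg j))

  -- The sets outside TC(Base) that may lie in TC(Base ∪ S_f).
  closuresZ : List HF
  closuresZ = concatᶠ (λ i → elems (TC (Z i)))

  gValues : List HF
  gValues = concatᶠ (λ j → map (λ X → eval (g j) X A) (box Z (αg j)))

  newOfF : Fin ℓ → List HF
  newOfF i = concatMap (λ Xf → concatMap (λ Xg → newSets (covf i) Xf (gValue Xg)) gTuples)
                       (box Z (αf i))

  extra : List HF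
  extra = closuresZ ++ (gValues ++ concatᶠ newOfF)

  length-box≤boxP : ∀ α → length (box Z α) ≤ evalP boxP sizes
  length-box≤boxP α = ≤-trans (length-box≤ Z α) (≤-reflexive (sym (evalP-prodP var sizes)))

  length-gTuples≤ : length gTuples ≤ evalP (prodP {m} (λ _ → boxP)) sizes
  length-gTuples≤ = ≤-trans (length-tuples≤ m _ (λ j → length-box≤boxP (αg j)))
                            (≤-reflexive (sym (evalP-prodP {m} (λ _ → boxP) sizes)))

  length-newOfF≤ : ∀ i → length (newOfF i) ≤ evalP (boxP ⊗ (prodP {m} (λ _ → boxP) ⊗ ps i)) sizes
  length-newOfF≤ i = ≤-trans
    (length-concatMap≤ _ (box Z (αf i)) λ Xf∈ → length-concatMap≤ _ gTuples λ {Xg} _ →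
       ≤-trans (newSets≤ (covf i) _ (gValue Xg))
               (evalP-mono (ps i) (λ i′ → cT-mono (inj₂ (box-∈⁺ Z (αf i) Xf∈ i′)))))
    (*-mono-≤ (length-box≤boxP (αf i)) (*-monoˡ-≤ _ length-gTuples≤))

  length-gValues≤ : length gValues ≤ sumᶠ {m} (λ _ → evalP boxP sizes)
  length-gValues≤ = length-concatᶠ≤ (λ j → map (λ X → eval (g j) X A) (box Z (αg j)))
    (λ j → ≤-trans (≤-reflexive (length-map _ (box Z (αg j)))) (length-box≤boxP (αg j)))

  length-extra≤ : length extra ≤ evalP (lemmaP m ps) sizes
  length-extra≤ = begin
    length extra                                                   ≡⟨ length-++ closuresZ ⟩
    length closuresZ + length (gValues ++ concatᶠ newOfF)          ≡⟨ cong (length closuresZ +_) (length-++ gValues) ⟩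
    length closuresZ + (length gValues + length (concatᶠ newOfF))  ≤⟨ +-mono-≤ length-closuresZ≤
                                                                        (+-mono-≤ length-gValues≤ length-newOfFs≤) ⟩
    sumᶠ sizes + (sumᶠ {m} (λ _ → evalP boxP sizes) + sumᶠ (λ i → evalP (newP i) sizes))
                                                                   ≡⟨ sym (cong₂ _+_ (evalP-sumP var sizes)
                                                                        (cong₂ _+_ (evalP-sumP {m} (λ _ → boxP) sizes)
                                                                                   (evalP-sumP newP sizes))) ⟩
    evalP (lemmaP m ps) sizes                                      ∎
    where
    open ≤-Reasoning
    newP : Fin ℓ → Poly n
    newP i = boxP ⊗ (prodP {m} (λ _ → boxP) ⊗ ps i)
    length-closuresZ≤ : length closuresZ ≤ sumᶠ sizes
    length-closuresZ≤ = length-concatᶠ≤ (λ i → elems (TC (Z i))) (λ i → ≤-refl)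
    length-newOfFs≤ : length (concatᶠ newOfF) ≤ sumᶠ (λ i → evalP (newP i) sizes)
    length-newOfFs≤ = length-concatᶠ≤ newOfF length-newOfF≤

  closuresZ⊆extra : ∀ i {y} → y ∈⁺ Z i → y ∈ extra
  closuresZ⊆extra i y∈ = ∈-++⁺ˡ (∈-concatᶠ⁺ (λ i → elems (TC (Z i))) i (∈-elems⁺ (∈-TC⁺ y∈)))

  gValue∈extra : ∀ j {X} → X ∈ box Z (αg j) → eval (g j) X A ∈ extra
  gValue∈extra j X∈ = ∈-++⁺ʳ closuresZ (∈-++⁺ˡ
    (∈-concatᶠ⁺ (λ j → map (λ X → eval (g j) X A) (box Z (αg j))) j (∈-map⁺ (λ X → eval (g j) X A) X∈)))

  newOfF⊆extra : ∀ i {Xf Xg y} → Xf ∈ box Z (αf i) → Xg ∈ gTuples →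
                 y ∈ newSets (covf i) Xf (gValue Xg) → y ∈ extra
  newOfF⊆extra i Xf∈ Xg∈ y∈N = ∈-++⁺ʳ closuresZ (∈-++⁺ʳ gValues (∈-concatᶠ⁺ newOfF i
    (∈-concatMap⁺ _ (lose Xf∈ (∈-concatMap⁺ _ (lose Xg∈ y∈N))))))

  below-gValue : ∀ j {X y} → X ∈ box Z (αg j) → y ∈⁺ eval (g j) X A → y ∈⁺ Base
  below-gValue j X∈ y∈ with ⁺-top y∈
  ... | w , w∈g , y∈w = ⁼-⁺-trans y∈w (direct (∈-∪⁺ʳ {a = B ∪ ⋃ᵥ A} (∈-Sg⁺ Z g A αg j X∈ w∈g)))

  from-source : ∀ i {Xf Xg y} → Xf ∈ box Z (αf i) → Xg ∈ gTuples →
                Source Xf (gValue Xg) (newSets (covf i) Xf (gValue Xg)) y →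
                y ∈⁺ Base ⊎ y ∈ extra
  from-source i Xf∈ Xg∈ (normal i′ y∈X)     = inj₂ (closuresZ⊆extra i′ (⁼-⁺-trans y∈X (box-∈⁺ Z (αf i) Xf∈ i′)))
  from-source i Xf∈ Xg∈ (safe j (inj₁ refl)) = inj₂ (gValue∈extra j (∈-tuples⁻ m (λ j → box Z (αg j)) Xg∈ j))
  from-source i Xf∈ Xg∈ (safe j (inj₂ y∈g))  = inj₁ (below-gValue j (∈-tuples⁻ m (λ j → box Z (αg j)) Xg∈ j) y∈g)
  from-source i Xf∈ Xg∈ (new y∈N)            = inj₂ (newOfF⊆extra i Xf∈ Xg∈ y∈N)

  below-Sf : ∀ {z y} → z ∈ₕ Sf Z f g A αg αf → y ∈⁼ z → y ∈⁺ Base ⊎ y ∈ extra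
  below-Sf {z} {y} z∈ y∈z = below-value (∈-Sf⁻ Z f g A αg αf z∈)
    where
    below-value : (∃ λ i → ∃ λ Xf → ∃ λ Xg → Xf ∈ box Z (αf i) × Xg ∈ gTuples × z ∈ₕ eval (f i) Xf (gValue Xg)) →
                  y ∈⁺ Base ⊎ y ∈ extra
    below-value (i , Xf , Xg , Xf∈ , Xg∈ , z∈f) =
      from-source i Xf∈ Xg∈ (covers (covf i) Xf (gValue Xg) (inj₂ (⁼-⁺-trans y∈z (direct z∈f))))

  TC-classified : ∀ {y} → y ∈⁺ Base ∪ Sf Z f g A αg αf → y ∈⁺ Base ⊎ y ∈ extra
  TC-classified y∈ with ⁺-top y∈
  ... | z , z∈ , y∈z = [ (λ z∈Base → inj₁ (⁼-⁺-trans y∈z (direct z∈Base))) , (λ z∈Sf → below-Sf z∈Sf y∈z) ]′ (∈-∪⁻ z∈)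

  bound : cT (Base ∪ Sf Z f g A αg αf) ≤ evalP (lemmaP m ps) sizes + cT Base
  bound = ≤-trans (cT-∪≤ Base (Sf Z f g A αg αf) extra TC-classified) (+-monoˡ-≤ (cT Base) length-extra≤)

lemma5p3 : (n m ℓ : ℕ) (f : Fin ℓ → PCSF n m) →
    Σ (Poly n) λ q → Monotonic q ×
      (∀ (Z : Vector HF n) (k : ℕ) (g : Fin m → PCSF n k) (A : Vector HF k) (B : HF)
         (αg : Fin m → Vector ℕ n) (αf : Fin ℓ → Vector ℕ n) →
         cT ((B ∪ ⋃ᵥ A) ∪ Sg Z g A αg ∪ Sf Z f g A αg αf)
           ≤ evalP q (λ i → cT (Z i)) + cT ((B ∪ ⋃ᵥ A) ∪ Sg Z g A αg))
lemma5p3 n m ℓ f =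
  lemmaP m (proj₁ ∘ covered ∘ f) ,
  sum-of-vars-monotonic (valuesAndNewP m (proj₁ ∘ covered ∘ f)) ,
  λ Z k g A B αg αf → Lemma5p3.bound f Z g A B αg αf
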